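{- Let $(G,\sigma)$ be a flow-admissible signed cubic graph with $N_\sigma=\{uv,xy\}$, and let $G^*=(V(G),E(G)\cup\{ux\}\setminus\{uv,xy\})$ be the unsigned graph obtained by deleting $uv,xy$ and adding a new edge $ux$. If no $2$-edge-cut of $G$ contains a negative edge, then $G^*$ is flow-admissible (i.e. admits a nowhere-zero $k$-flow for some $k$).
   Context: Graphs are finite and may have parallel edges. A signed graph $(G,\sigma)$ is a graph $G$ with a map $\sigma:E(G)\to\{ -1,1\}$; $N_\sigma=\sigma^{ -1}(-1)$ is the set of negative edges. An edge-cut is the set of all edges with one end in $W$ and the other in $V(G)\setminus W$, for some $\emptyset\ne W\subsetneq V(G)$; a $2$-edge-cut is one with two edges. Each edge $e=vw$ consists of two half-edges $h_v(e)$, $h_w(e)$. An orientation $D$ directs each half-edge towards or away from its end vertex so that for a positive edge exactly one half-edge is directed towards its end vertex, and for a negative edge both half-edges are directed away or both towards their end vertices. A $\mathbb{Z}$-flow $(D,\phi)$: $\phi:E(G)\to\mathbb{Z}$ such that at every vertex $v$ the sum of $\phi(e)$ over half-edges at $v$ directed towards $v$ equals the sum over half-edges directed away from $v$. A nowhere-zero $k$-flow is a $\mathbb{Z}$-flow with $0<|\phi(e)|<k$ for all $e$. A signed or unsigned graph (the latter viewed with all edges positive) is flow-admissible if it admits a nowhere-zero $k$-flow for some $k$. -}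

module Defs where

open import Data.Nat as ℕ using (ℕ; zero; suc)
open import Data.Integer as ℤ using (ℤ; +_; 0ℤ; ∣_∣)
open import Data.Fin using (Fin; zero; suc; _≟_)
open import Data.Bool using (Bool; true; false; T; not; if_then_else_)
open import Data.Sign using (Sign)
open import Data.List using (List; length; lookup; allFin; filter; map; _∷_)
open import Data.Product using (_×_; _,_; proj₁; proj₂; Σ; ∃; ∃-syntax)
open import Data.Sum using (_⊎_)
open import Relation.Nullary using (¬_; does)
open import Relation.Nullary.Decidable using (_×-dec_; ¬?)
open import Relation.Binary.PropositionalEquality using (_≡_; _≢_)

-- Finite graphs (parallel edges, and loops, allowed).
-- A graph on vertex set Fin n is the list of its edges, each edge
-- given by its ordered pair of ends (first half-edge, second half-edge).

Graph : ℕ → Set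
Graph n = List (Fin n × Fin n)

Edge : ∀ {n} → Graph n → Set
Edge G = Fin (length G)

ends : ∀ {n} (G : Graph n) → Edge G → Fin n × Fin n
ends G e = lookup G e

end₁ end₂ : ∀ {n} (G : Graph n) → Edge G → Fin n
end₁ G e = proj₁ (ends G e)
end₂ G e = proj₂ (ends G e)

ΣFinℕ : ∀ m → (Fin m → ℕ) → ℕ
ΣFinℕ zero    f = 0
ΣFinℕ (suc m) f = f zero ℕ.+ ΣFinℕ m (λ i → f (suc i))

ΣFinℤ : ∀ m → (Fin m → ℤ) → ℤ
ΣFinℤ zero    f = 0ℤ
ΣFinℤ (suc m) f = f zero ℤ.+ ΣFinℤ m (λ i → f (suc i))

[_≟ᵛ_] : ∀ {n} → Fin n → Fin n → ℕ
[ a ≟ᵛ b ] = if does (a ≟ b) then 1 else 0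

-- degree: number of half-edges at v (a loop counts twice)
degree : ∀ {n} (G : Graph n) → Fin n → ℕ
degree G v = ΣFinℕ (length G) (λ e → [ end₁ G e ≟ᵛ v ] ℕ.+ [ end₂ G e ≟ᵛ v ])

Cubic : ∀ {n} → Graph n → Set
Cubic {n} G = (v : Fin n) → degree G v ≡ 3

Signature : ∀ {n} → Graph n → Set
Signature G = Edge G → Sign

allPositive : ∀ {n} (G : Graph n) → Signature G
allPositive G _ = Sign.+

-- An orientation directs each half-edge: true = towards its end vertex,
-- false = away from it.  Positive edge: exactly one half-edge towards;
-- negative edge: both towards or both away.
record Orientation {n} (G : Graph n) (σ : Signature G) : Set where
  field
    dir₁ dir₂ : Edge G → Bool
    valid₊ : ∀ e → σ e ≡ Sign.+ → dir₁ e ≡ not (dir₂ e)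
    valid₋ : ∀ e → σ e ≡ Sign.- → dir₁ e ≡ dir₂ e
open Orientation public

halfVal : ∀ {n} → Fin n → Bool → Fin n → Bool → ℤ → ℤ
halfVal w dw v d x = if does (w ≟ v) then (if dw Data.Bool.∧ d then x else (if not dw Data.Bool.∧ not d then x else 0ℤ)) else 0ℤ
  where import Data.Bool

-- sum of φ(e) over half-edges at v directed towards v (d = true)
-- resp. away from v (d = false)
dirSum : ∀ {n} (G : Graph n) {σ : Signature G} → Orientation G σ →
         (Edge G → ℤ) → Fin n → Bool → ℤ
dirSum G D φ v d = ΣFinℤ (length G) (λ e →
  halfVal (end₁ G e) (dir₁ D e) v d (φ e) ℤ.+ halfVal (end₂ G e) (dir₂ D e) v d (φ e))

IsFlow : ∀ {n} (G : Graph n) {σ : Signature G} → Orientation G σ → (Edge G → ℤ) → Set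
IsFlow {n} G D φ = (v : Fin n) → dirSum G D φ v true ≡ dirSum G D φ v false

IsNZFlow : ∀ {n} (G : Graph n) {σ : Signature G} → ℕ → Orientation G σ → (Edge G → ℤ) → Set
IsNZFlow G k D φ = IsFlow G D φ × (∀ e → 0 ℕ.< ∣ φ e ∣ × ∣ φ e ∣ ℕ.< k)

FlowAdmissible : ∀ {n} (G : Graph n) → Signature G → Set
FlowAdmissible G σ = ∃[ k ] Σ (Orientation G σ) λ D → ∃[ φ ] IsNZFlow G k D φ

FlowAdmissibleUnsigned : ∀ {n} → Graph n → Set
FlowAdmissibleUnsigned G = FlowAdmissible G (allPositive G)

ProperSubset : ℕ → Set
ProperSubset n = Σ (Fin n → Bool) λ W → (∃[ a ] W a ≡ true) × (∃[ b ] W b ≡ false)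

InCut : ∀ {n} (G : Graph n) → (Fin n → Bool) → Edge G → Set
InCut G W e = W (end₁ G e) ≢ W (end₂ G e)

cutSize : ∀ {n} (G : Graph n) → (Fin n → Bool) → ℕ
cutSize G W = ΣFinℕ (length G) λ e →
  if does (W (end₁ G e) Data.Bool.≟ W (end₂ G e)) then 0 else 1
  where import Data.Bool

No2CutWithNegEdge : ∀ {n} (G : Graph n) → Signature G → Set
No2CutWithNegEdge {n} G σ = (W : ProperSubset n) → cutSize G (proj₁ W) ≡ 2 →
  ∀ e → σ e ≡ Sign.- → ¬ InCut G (proj₁ W) e

deleteTwoAdd : ∀ {n} (G : Graph n) → Edge G → Edge G → Fin n → Fin n → Graph n
deleteTwoAdd G e₁ e₂ u x =
  (u , x) ∷ map (ends G) (filter (λ e → ¬? (e ≟ e₁) ×-dec ¬? (e ≟ e₂)) (allFin (length G)))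

-- A nowhere-zero flow φ on (G, σ) has zero net inflow into every vertex set W.  A positive
-- edge contributes nothing when its ends lie on the same side of W and ±φ(e) ≠ 0 when it
-- crosses; a negative edge with ends a, b contributes ([a ∈ W] + [b ∈ W]) φ₁(e), where φ₁(e)
-- is φ(e) as seen from one end.  Taking W = V(G) gives φ₁(uv) = −φ₁(xy).  Now let W be a
-- bridge of G*.  If u and x lie on the same side, exactly one positive edge of G crosses W,
-- and the balance forces v and y onto different sides; otherwise no positive edge crosses,
-- and the balance puts v on the side of x and y on the side of u.  Either way W cuts exactly
-- two edges of G, one of them negative, which is excluded.  So G* is bridgeless.  A search
-- from one end of an edge that avoids the edge reaches its other end, lest the edge be a
-- bridge; this yields a circulation fₑ with fₑ(e) = 1, and Σ Kⁱ fᵢ for K larger than all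
-- |fᵢ| is a flow whose value at e has the nonzero base-K digit fₑ(e).

module Submission where

open import Defs
open import Data.Nat using (ℕ)
open import Data.Fin using (Fin)
open import Data.Sign using (Sign)
open import Data.Product using (_×_; _,_)
open import Data.Sum using (_⊎_)
open import Relation.Binary.PropositionalEquality using (_≡_; _≢_)

open import Algebra.Bundles using (CommutativeMonoid)
open import Data.Bool as Bool using (Bool; true; false; not; if_then_else_)
open import Data.Fin using (zero; suc; _≟_)
open import Data.Fin.Properties using (any?; ¬∀⟶∃¬)
open import Data.Fin.Subset using (Subset; _∈_; _∉_; _⊆_; _⊈_; _⊂_; ⁅_⁆) renaming (∣_∣ to ∣_∣ˢ)
open import Data.Fin.Subset.Properties using (_∈?_; _⊆?_; p⊂q⇒∣p∣<∣q∣; ∣p∣≤n; x∈⁅x⁆; x∈⁅y⁆⇒x≡y)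
open import Data.Integer as ℤ using (ℤ; 0ℤ; 1ℤ; -1ℤ; -_; _+_; _*_; _-_; ∣_∣)
import Data.Integer.Properties as ℤP
open import Algebra.Properties.AbelianGroup ℤP.+-0-abelianGroup using (identityʳ-unique; inverseˡ-unique; inverseʳ-unique)
open import Data.Integer.Tactic.RingSolver using (solve-∀)
open import Data.List as List using (List; []; _∷_; length; lookup; tabulate; filter)
import Data.List.Properties as List
import Data.Nat.ListAction as ListAction
open import Data.Nat as ℕ using (suc; _≤_; _<_; z≤n; s≤s; ≢-nonZero)
import Data.Nat.Properties as ℕP
open import Data.Nat.GeneralisedArithmetic using (fold)
open import Data.Product using (Σ; ∃; proj₁; proj₂)
open import Data.Sum as Sum using (inj₁; inj₂; [_,_]′)
import Data.Vec as Vec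
open import Data.Vec.Properties using (lookup∘tabulate; []=⇒lookup; lookup⇒[]=)
open import Function using (_∘_; _⇔_; mk⇔; Equivalence)
open import Function.Construct.Composition using (_⇔-∘_)
open import Relation.Nullary using (yes; no; does; contradiction)
open import Relation.Nullary.Decidable using (dec-true; dec-false; decidable-stable; _×-dec_; _⊎-dec_; _→-dec_; ¬?)
open import Relation.Unary using (Pred; Decidable)
open import Relation.Binary.PropositionalEquality
  using (refl; sym; trans; cong; cong₂; subst; module ≡-Reasoning)

module Erasure {c ℓ} (M : CommutativeMonoid c ℓ) where
  open CommutativeMonoid M
    using (Carrier; _≈_; _∙_; setoid; commutativeSemigroup; ∙-congˡ; identityˡ; identityʳ)
    renaming (ε to 0#; sym to ≈-sym; trans to ≈-trans; reflexive to ≈-reflexive)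
  open import Algebra.Properties.CommutativeMonoid.Sum M using (sum; sum-cong-≗; sum-replicate-zero)
  open import Algebra.Properties.CommutativeSemigroup commutativeSemigroup using (x∙yz≈y∙xz)
  open import Relation.Binary.Reasoning.Setoid setoid

  erase : ∀ {m} → Fin m → (Fin m → Carrier) → Fin m → Carrier
  erase a f i = if does (i ≟ a) then 0# else f i

  erase-≢ : ∀ {m} {a i : Fin m} (f : Fin m → Carrier) → i ≢ a → erase a f i ≡ f i
  erase-≢ {a = a} {i} f i≢a with i ≟ a
  ... | yes i≡a = contradiction i≡a i≢a
  ... | no _    = refl

  erase-vanishes : ∀ {m} (a : Fin m) {f : Fin m → Carrier} → (∀ i → i ≢ a → f i ≡ 0#) →
                   ∀ i → erase a f i ≡ 0#
  erase-vanishes a f≡0 i with i ≟ a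
  ... | yes _   = refl
  ... | no i≢a  = f≡0 i i≢a

  sum-zero : ∀ {m} (f : Fin m → Carrier) → (∀ i → f i ≡ 0#) → sum f ≈ 0#
  sum-zero {m} f f≡0 = ≈-trans (≈-reflexive (sum-cong-≗ f≡0)) (sum-replicate-zero m)

  sum-erase : ∀ {m} (a : Fin m) (f : Fin m → Carrier) → sum f ≈ f a ∙ sum (erase a f)
  sum-erase zero    f = ∙-congˡ (≈-sym (identityˡ _))
  sum-erase (suc a) f = begin
    f zero ∙ sum (f ∘ suc)                          ≈⟨ ∙-congˡ (sum-erase a (f ∘ suc)) ⟩
    f zero ∙ (f (suc a) ∙ sum (erase a (f ∘ suc)))  ≈⟨ x∙yz≈y∙xz _ _ _ ⟩
    f (suc a) ∙ (f zero ∙ sum (erase a (f ∘ suc)))  ∎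

  sum-erase₂ : ∀ {m} {a b : Fin m} (f : Fin m → Carrier) → a ≢ b →
               sum f ≈ f a ∙ (f b ∙ sum (erase b (erase a f)))
  sum-erase₂ {a = a} {b} f a≢b = begin
    sum f                                      ≈⟨ sum-erase a f ⟩
    f a ∙ sum (erase a f)                      ≈⟨ ∙-congˡ (sum-erase b (erase a f)) ⟩
    f a ∙ (erase a f b ∙ sum (erase b (erase a f)))
      ≡⟨ cong (λ z → f a ∙ (z ∙ sum (erase b (erase a f)))) (erase-≢ f (a≢b ∘ sym)) ⟩
    f a ∙ (f b ∙ sum (erase b (erase a f)))    ∎

  sum-supported : ∀ {m} (a : Fin m) (f : Fin m → Carrier) → (∀ i → i ≢ a → f i ≡ 0#) →
                  sum f ≈ f a
  sum-supported a f f≡0 = begin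
    sum f                  ≈⟨ sum-erase a f ⟩
    f a ∙ sum (erase a f)  ≈⟨ ∙-congˡ (sum-zero (erase a f) (erase-vanishes a f≡0)) ⟩
    f a ∙ 0#               ≈⟨ identityʳ (f a) ⟩
    f a                    ∎

module ℕΣ where
  open import Algebra.Properties.CommutativeMonoid.Sum ℕP.+-0-commutativeMonoid public
    using (sum; sum-cong-≗)
  open Erasure ℕP.+-0-commutativeMonoid public

module ℤΣ where
  open import Algebra.Properties.Semiring.Sum ℤP.+-*-semiring public
    using (sum; sum-cong-≗; ∑-comm; ∑-distrib-+; *-distribˡ-sum)
  open Erasure ℤP.+-0-commutativeMonoid public

ΣFinℕ≡sum : ∀ m (f : Fin m → ℕ) → ΣFinℕ m f ≡ ℕΣ.sum f
ΣFinℕ≡sum ℕ.zero    f = refl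
ΣFinℕ≡sum (ℕ.suc m) f = cong (f zero ℕ.+_) (ΣFinℕ≡sum m (f ∘ suc))

ΣFinℤ≡sum : ∀ m (f : Fin m → ℤ) → ΣFinℤ m f ≡ ℤΣ.sum f
ΣFinℤ≡sum ℕ.zero    f = refl
ΣFinℤ≡sum (ℕ.suc m) f = cong (λ z → f zero + z) (ΣFinℤ≡sum m (f ∘ suc))

term≤sum : ∀ {m} (f : Fin m → ℕ) a → f a ≤ ℕΣ.sum f
term≤sum f a = ℕP.≤-trans (ℕP.m≤m+n (f a) _) (ℕP.≤-reflexive (sym (ℕΣ.sum-erase a f)))

sum≡0⇒≡0 : ∀ {m} (f : Fin m → ℕ) → ℕΣ.sum f ≡ 0 → ∀ i → f i ≡ 0
sum≡0⇒≡0 f Σf≡0 i = ℕP.n≤0⇒n≡0 (subst (f i ≤_) Σf≡0 (term≤sum f i))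

sum≤1⇒unique-nonzero : ∀ {m} (f : Fin m → ℕ) → ℕΣ.sum f ≤ 1 → ∀ {c} → f c ≢ 0 → ∀ i → i ≢ c → f i ≡ 0
sum≤1⇒unique-nonzero f Σf≤1 {c} fc≢0 i i≢c = trans (sym (ℕΣ.erase-≢ f i≢c)) (sum≡0⇒≡0 _ erased≡0 i)
  where
  erased≡0 : ℕΣ.sum (ℕΣ.erase c f) ≡ 0
  erased≡0 = ℕP.n≤0⇒n≡0 (ℕP.+-cancelˡ-≤ 1 _ 0 (ℕP.≤-trans
    (ℕP.+-monoˡ-≤ _ (ℕP.n≢0⇒n>0 fc≢0)) (subst (_≤ 1) (ℕΣ.sum-erase c f) Σf≤1)))

sum≡0⇔sum≡0 : ∀ {m} (f : Fin m → ℕ) (g : Fin m → ℤ) → (∀ i → f i ≡ 0 ⇔ g i ≡ 0ℤ) →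
              ℕΣ.sum f ≤ 1 → (ℕΣ.sum f ≡ 0 ⇔ ℤΣ.sum g ≡ 0ℤ)
sum≡0⇔sum≡0 f g zeros Σf≤1 = mk⇔ to from
  where
  to : ℕΣ.sum f ≡ 0 → ℤΣ.sum g ≡ 0ℤ
  to Σf≡0 = ℤΣ.sum-zero g (λ i → Equivalence.to (zeros i) (sum≡0⇒≡0 f Σf≡0 i))

  from : ℤΣ.sum g ≡ 0ℤ → ℕΣ.sum f ≡ 0
  from Σg≡0 with any? (λ i → ¬? (f i ℕ.≟ 0))
  ... | no  none         = ℕΣ.sum-zero f (λ i → decidable-stable (f i ℕ.≟ 0) (λ fi≢0 → none (i , fi≢0)))
  ... | yes (c , fc≢0)   = contradiction (Equivalence.from (zeros c) gc≡0) fc≢0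
    where
    gc≡0 : g c ≡ 0ℤ
    gc≡0 = trans (sym (ℤΣ.sum-supported c g λ i i≢c →
                   Equivalence.to (zeros i) (sum≤1⇒unique-nonzero f Σf≤1 fc≢0 i i≢c))) Σg≡0

δ : ∀ {k} → Fin k → Fin k → ℤ
δ i j = if does (i ≟ j) then 1ℤ else 0ℤ

δ-≢ : ∀ {k} {i j : Fin k} → i ≢ j → δ i j ≡ 0ℤ
δ-≢ {i = i} {j} i≢j with i ≟ j
... | yes i≡j = contradiction i≡j i≢j
... | no _    = refl

δ-refl : ∀ {k} (i : Fin k) → δ i i ≡ 1ℤ
δ-refl i with i ≟ i
... | yes _   = refl
... | no i≢i  = contradiction refl i≢i

sum-δ : ∀ {k} (i : Fin k) (f : Fin k → ℤ) → ℤΣ.sum (λ j → δ i j * f j) ≡ f i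
sum-δ i f = trans (ℤΣ.sum-supported i _ (λ j j≢i → cong (_* f j) (δ-≢ (j≢i ∘ sym))))
                  (trans (cong (_* f i) (δ-refl i)) (ℤP.*-identityˡ (f i)))

x+y*0≡x : ∀ x y → x + y * 0ℤ ≡ x
x+y*0≡x x y = trans (cong (x +_) (ℤP.*-zeroʳ y)) (ℤP.+-identityʳ x)

𝟙 : Bool → ℤ
𝟙 true  = 1ℤ
𝟙 false = 0ℤ

differ : Bool → Bool → ℕ
differ a b = if does (a Bool.≟ b) then 0 else 1

crossing : ∀ {n} → (Fin n → Bool) → Fin n × Fin n → ℕ
crossing W p = differ (W (proj₁ p)) (W (proj₂ p))

Joins : ∀ {n} (G : Graph n) → Edge G → Fin n → Fin n → Set
Joins G e a b = ends G e ≡ (a , b) ⊎ ends G e ≡ (b , a)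

Bridgeless : ∀ {n} → Graph n → Set
Bridgeless {n} G = (W : ProperSubset n) → cutSize G (proj₁ W) ≢ 1

differ-comm : ∀ a b → differ a b ≡ differ b a
differ-comm true  true  = refl
differ-comm true  false = refl
differ-comm false true  = refl
differ-comm false false = refl

crossing-joins : ∀ {n} (G : Graph n) e {a b} (W : Fin n → Bool) → Joins G e a b →
                 crossing W (ends G e) ≡ differ (W a) (W b)
crossing-joins G e W (inj₁ ends≡ab) rewrite ends≡ab = refl
crossing-joins G e {a} {b} W (inj₂ ends≡ba) rewrite ends≡ba = differ-comm (W b) (W a)

inCut-joins : ∀ {n} (G : Graph n) e {a b} (W : Fin n → Bool) → Joins G e a b →
              W a ≢ W b → InCut G W e
inCut-joins G e W (inj₁ ends≡ab) Wa≢Wb rewrite ends≡ab = Wa≢Wb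
inCut-joins G e W (inj₂ ends≡ba) Wa≢Wb rewrite ends≡ba = Wa≢Wb ∘ sym

cutSize≡sum : ∀ {n} (G : Graph n) W → cutSize G W ≡ ℕΣ.sum (crossing W ∘ ends G)
cutSize≡sum G W = ΣFinℕ≡sum (length G) (crossing W ∘ ends G)

sum-lookup : ∀ {A : Set} (h : A → ℕ) (xs : List A) →
             ΣFinℕ (length xs) (h ∘ lookup xs) ≡ ListAction.sum (List.map h xs)
sum-lookup h []       = refl
sum-lookup h (x ∷ xs) = cong (h x ℕ.+_) (sum-lookup h xs)

sum-filter-tabulate : ∀ {A : Set} {p} {P : Pred A p} (P? : Decidable P) (h : A → ℕ) m (f : Fin m → A) →
  ListAction.sum (List.map h (filter P? (tabulate f))) ≡ ℕΣ.sum (λ i → if does (P? (f i)) then h (f i) else 0)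
sum-filter-tabulate P? h ℕ.zero    f = refl
sum-filter-tabulate P? h (ℕ.suc m) f with does (P? (f zero))
... | true  = cong (h (f zero) ℕ.+_) (sum-filter-tabulate P? h m (f ∘ suc))
... | false = sum-filter-tabulate P? h m (f ∘ suc)

cutSize-deleteTwoAdd : ∀ {n} (G : Graph n) (e₁ e₂ : Edge G) (u x : Fin n) W →
  cutSize (deleteTwoAdd G e₁ e₂ u x) W
    ≡ differ (W u) (W x) ℕ.+ ℕΣ.sum (ℕΣ.erase e₂ (ℕΣ.erase e₁ (crossing W ∘ ends G)))
cutSize-deleteTwoAdd G e₁ e₂ u x W = cong (differ (W u) (W x) ℕ.+_) (begin
  ΣFinℕ (length kept) (crossing W ∘ lookup kept)    ≡⟨ sum-lookup (crossing W) kept ⟩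
  ListAction.sum (List.map (crossing W) kept)       ≡⟨ cong ListAction.sum (List.map-∘ (filter P? (List.allFin _))) ⟨
  ListAction.sum (List.map (crossing W ∘ ends G) (filter P? (List.allFin _)))
    ≡⟨ sum-filter-tabulate P? (crossing W ∘ ends G) (length G) (λ e → e) ⟩
  ℕΣ.sum (λ e → if does (P? e) then crossing W (ends G e) else 0)
    ≡⟨ ℕΣ.sum-cong-≗ kept-only ⟩
  ℕΣ.sum (ℕΣ.erase e₂ (ℕΣ.erase e₁ (crossing W ∘ ends G)))  ∎)
  where
  open ≡-Reasoning
  P? : Decidable (λ e → e ≢ e₁ × e ≢ e₂)
  P? e = ¬? (e ≟ e₁) ×-dec ¬? (e ≟ e₂)
  kept : Graph _
  kept = List.map (ends G) (filter P? (List.allFin (length G)))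
  kept-only : ∀ e → (if does (P? e) then crossing W (ends G e) else 0)
                    ≡ ℕΣ.erase e₂ (ℕΣ.erase e₁ (crossing W ∘ ends G)) e
  kept-only e with e ≟ e₁ | e ≟ e₂
  ... | yes _ | yes _ = refl
  ... | yes _ | no _  = refl
  ... | no _  | yes _ = refl
  ... | no _  | no _  = refl

-- Flows as vertex-balanced edge functions

inflow : Bool → ℤ → ℤ
inflow true  x = x
inflow false x = - x

inflow-linear : ∀ d a c b → inflow d (a + c * b) ≡ inflow d a + c * inflow d b
inflow-linear true  a c b = refl
inflow-linear false a c b = negated a c b
  where
  negated : ∀ a c b → - (a + c * b) ≡ - a + c * - b
  negated = solve-∀

netInflow : ∀ {n} (G : Graph n) {σ : Signature G} → Orientation G σ → (Edge G → ℤ) → Fin n → ℤ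
netInflow G D φ v = ℤΣ.sum λ e →
  δ (end₁ G e) v * inflow (dir₁ D e) (φ e) + δ (end₂ G e) v * inflow (dir₂ D e) (φ e)

halfVal-towards : ∀ {n} (w v : Fin n) d x → halfVal w d v true x ≡ halfVal w d v false x + δ w v * inflow d x
halfVal-towards w v d x with does (w ≟ v) | d
... | true  | true  = sym (trans (ℤP.+-identityˡ _) (ℤP.*-identityˡ x))
... | true  | false = sym (trans (cong (x +_) (ℤP.*-identityˡ (- x))) (ℤP.+-inverseʳ x))
... | false | _     = refl

dirSum-towards : ∀ {n} (G : Graph n) {σ : Signature G} (D : Orientation G σ) φ v →
                 dirSum G D φ v true ≡ dirSum G D φ v false + netInflow G D φ v
dirSum-towards G D φ v = begin
  dirSum G D φ v true                               ≡⟨ ΣFinℤ≡sum (length G) _ ⟩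
  ℤΣ.sum (λ e → half₁ e true + half₂ e true)        ≡⟨ ℤΣ.sum-cong-≗ split ⟩
  ℤΣ.sum (λ e → (half₁ e false + half₂ e false) + net e)
                                                    ≡⟨ ℤΣ.∑-distrib-+ (λ e → half₁ e false + half₂ e false) net ⟩
  ℤΣ.sum (λ e → half₁ e false + half₂ e false) + netInflow G D φ v
                                                    ≡⟨ cong (_+ netInflow G D φ v) (ΣFinℤ≡sum (length G) _) ⟨
  dirSum G D φ v false + netInflow G D φ v          ∎
  where
  open ≡-Reasoning
  half₁ half₂ : Edge G → Bool → ℤ
  half₁ e = λ d → halfVal (end₁ G e) (dir₁ D e) v d (φ e)
  half₂ e = λ d → halfVal (end₂ G e) (dir₂ D e) v d (φ e)
  net : Edge G → ℤ
  net e = δ (end₁ G e) v * inflow (dir₁ D e) (φ e) + δ (end₂ G e) v * inflow (dir₂ D e) (φ e)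
  regroup : ∀ a b c d → (a + c) + (b + d) ≡ (a + b) + (c + d)
  regroup = solve-∀
  split : ∀ e → half₁ e true + half₂ e true ≡ (half₁ e false + half₂ e false) + net e
  split e = trans (cong₂ _+_ (halfVal-towards (end₁ G e) v (dir₁ D e) (φ e))
                             (halfVal-towards (end₂ G e) v (dir₂ D e) (φ e)))
                  (regroup (half₁ e false) (half₂ e false)
                           (δ (end₁ G e) v * inflow (dir₁ D e) (φ e)) (δ (end₂ G e) v * inflow (dir₂ D e) (φ e)))

isFlow⇔balanced : ∀ {n} (G : Graph n) {σ : Signature G} (D : Orientation G σ) φ →
                  IsFlow G D φ ⇔ (∀ v → netInflow G D φ v ≡ 0ℤ)
isFlow⇔balanced G D φ = mk⇔
  (λ flow v → identityʳ-unique _ _ (trans (sym (dirSum-towards G D φ v)) (flow v)))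
  (λ balanced v → trans (dirSum-towards G D φ v)
                        (trans (cong (dirSum G D φ v false +_) (balanced v)) (ℤP.+-identityʳ _)))

netInflow-linear : ∀ {n} (G : Graph n) {σ : Signature G} (D : Orientation G σ) p c q v →
  netInflow G D (λ e → p e + c * q e) v ≡ netInflow G D p v + c * netInflow G D q v
netInflow-linear G D p c q v = begin
  ℤΣ.sum (λ e → term₁ e (p e + c * q e) + term₂ e (p e + c * q e))
    ≡⟨ ℤΣ.sum-cong-≗ (λ e → cong₂ _+_ (spread₁ e) (spread₂ e)) ⟩
  ℤΣ.sum (λ e → (term₁ e (p e) + c * term₁ e (q e)) + (term₂ e (p e) + c * term₂ e (q e)))
    ≡⟨ ℤΣ.sum-cong-≗ (λ e → regroup (term₁ e (p e)) (term₂ e (p e)) (term₁ e (q e)) (term₂ e (q e)) c) ⟩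
  ℤΣ.sum (λ e → (term₁ e (p e) + term₂ e (p e)) + c * (term₁ e (q e) + term₂ e (q e)))
    ≡⟨ ℤΣ.∑-distrib-+ (λ e → term₁ e (p e) + term₂ e (p e)) (λ e → c * (term₁ e (q e) + term₂ e (q e))) ⟩
  netInflow G D p v + ℤΣ.sum (λ e → c * (term₁ e (q e) + term₂ e (q e)))
    ≡⟨ cong (netInflow G D p v +_) (ℤΣ.*-distribˡ-sum c (λ e → term₁ e (q e) + term₂ e (q e))) ⟨
  netInflow G D p v + c * netInflow G D q v   ∎
  where
  open ≡-Reasoning
  term₁ term₂ : Edge G → ℤ → ℤ
  term₁ e x = δ (end₁ G e) v * inflow (dir₁ D e) x
  term₂ e x = δ (end₂ G e) v * inflow (dir₂ D e) x
  scaled : ∀ w a k b → w * (a + k * b) ≡ w * a + k * (w * b)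
  scaled = solve-∀
  spread₁ : ∀ e → term₁ e (p e + c * q e) ≡ term₁ e (p e) + c * term₁ e (q e)
  spread₁ e = trans (cong (δ (end₁ G e) v *_) (inflow-linear (dir₁ D e) (p e) c (q e)))
                    (scaled (δ (end₁ G e) v) (inflow (dir₁ D e) (p e)) c (inflow (dir₁ D e) (q e)))
  spread₂ : ∀ e → term₂ e (p e + c * q e) ≡ term₂ e (p e) + c * term₂ e (q e)
  spread₂ e = trans (cong (δ (end₂ G e) v *_) (inflow-linear (dir₂ D e) (p e) c (q e)))
                    (scaled (δ (end₂ G e) v) (inflow (dir₂ D e) (p e)) c (inflow (dir₂ D e) (q e)))
  regroup : ∀ a b a′ b′ k → (a + k * a′) + (b + k * b′) ≡ (a + b) + k * (a′ + b′)
  regroup = solve-∀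

netInflow-zero : ∀ {n} (G : Graph n) {σ : Signature G} (D : Orientation G σ) v →
                 netInflow G D (λ _ → 0ℤ) v ≡ 0ℤ
netInflow-zero G D v = ℤΣ.sum-zero _ λ e →
  cong₂ _+_ (vanish (end₁ G e) (dir₁ D e)) (vanish (end₂ G e) (dir₂ D e))
  where
  vanish : ∀ w d → δ w v * inflow d 0ℤ ≡ 0ℤ
  vanish w true  = ℤP.*-zeroʳ (δ w v)
  vanish w false = ℤP.*-zeroʳ (δ w v)

-- Bridgeless graphs are flow-admissible

towardsEnd₁ : ∀ {n} (G : Graph n) → Orientation G (allPositive G)
towardsEnd₁ G = record
  { dir₁ = λ _ → true ; dir₂ = λ _ → false ; valid₊ = λ _ _ → refl ; valid₋ = λ _ () }

netInflow-δ : ∀ {n} (G : Graph n) e v →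
              netInflow G (towardsEnd₁ G) (δ e) v ≡ δ (end₁ G e) v - δ (end₂ G e) v
netInflow-δ G e v =
  trans (ℤΣ.sum-cong-≗ (λ e′ → factor (δ (end₁ G e′) v) (δ (end₂ G e′) v) (δ e e′)))
        (sum-δ e (λ e′ → δ (end₁ G e′) v - δ (end₂ G e′) v))
  where
  factor : ∀ a b d → a * d + b * - d ≡ d * (a - b)
  factor = solve-∀

select : ∀ {n p} {P : Pred (Fin n) p} → Decidable P → Subset n
select P? = Vec.tabulate (does ∘ P?)

∈-select⁺ : ∀ {n p} {P : Pred (Fin n) p} (P? : Decidable P) {x} → P x → x ∈ select P?
∈-select⁺ P? {x} px = lookup⇒[]= x (select P?) (trans (lookup∘tabulate (does ∘ P?) x) (dec-true (P? x) px))

∈-select⁻ : ∀ {n p} {P : Pred (Fin n) p} (P? : Decidable P) {x} → x ∈ select P? → P x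
∈-select⁻ P? {x} x∈ with P? x | trans (sym (lookup∘tabulate (does ∘ P?) x)) ([]=⇒lookup x∈)
... | yes px | _  = px
... | no  _  | ()

module _ {n} (F : Subset n → Subset n) (inflationary : ∀ p → p ⊆ F p)
         (monotone : ∀ {p q} → p ⊆ q → F p ⊆ F q) where

  private
    grows : ∀ p → F p ⊈ p → p ⊂ F p
    grows p Fp⊈p with ¬∀⟶∃¬ n (λ x → x ∈ F p → x ∈ p) (λ x → (x ∈? F p) →-dec (x ∈? p))
                               (λ kept → Fp⊈p (kept _))
    ... | x , escapes with x ∈? F p
    ...   | yes x∈Fp = inflationary p , x , x∈Fp , λ x∈p → escapes (λ _ → x∈p)
    ...   | no  x∉Fp = contradiction (λ x∈Fp → contradiction x∈Fp x∉Fp) escapes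

    unstable-large : ∀ p k → F (fold p F k) ⊈ fold p F k → k < ∣ fold p F (suc k) ∣ˢ
    unstable-large p ℕ.zero    unstable = ℕP.≤-<-trans z≤n (p⊂q⇒∣p∣<∣q∣ (grows p unstable))
    unstable-large p (ℕ.suc k) unstable =
      ℕP.≤-<-trans (unstable-large p k (λ stable → unstable (monotone stable)))
                   (p⊂q⇒∣p∣<∣q∣ (grows _ unstable))

  fixpoint-within : ∀ p → F (fold p F n) ⊆ fold p F n
  fixpoint-within p with F (fold p F n) ⊆? fold p F n
  ... | yes stable  = stable
  ... | no unstable = contradiction (unstable-large p n unstable) (ℕP.≤⇒≯ (∣p∣≤n (F (fold p F n))))

  fold-⊇ : ∀ p k → p ⊆ fold p F k
  fold-⊇ p ℕ.zero    x∈p = x∈p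
  fold-⊇ p (ℕ.suc k) x∈p = inflationary _ (fold-⊇ p k x∈p)

module Reachability {n} (G : Graph n) (e₀ : Edge G) where
  private
    s t : Fin n
    s = end₁ G e₀
    t = end₂ G e₀

    D : Orientation G (allPositive G)
    D = towardsEnd₁ G

  -- a flow routing one unit from s to r without using e₀
  Route : Fin n → Set
  Route r = Σ (Edge G → ℤ) λ p → p e₀ ≡ 0ℤ × (∀ v → netInflow G D p v ≡ δ r v - δ s v)

  route-start : Route s
  route-start = (λ _ → 0ℤ) , refl , λ v → trans (netInflow-zero G D v) (sym (ℤP.+-inverseʳ (δ s v)))

  route-along : ∀ {r r′} c e → e ≢ e₀ → (∀ v → c * (δ (end₁ G e) v - δ (end₂ G e) v) ≡ δ r′ v - δ r v) →
                Route r → Route r′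
  route-along {r} {r′} c e e≢e₀ shift (p , p₀ , balance) =
    (λ e′ → p e′ + c * δ e e′) , avoids , balance′
    where
    avoids : p e₀ + c * δ e e₀ ≡ 0ℤ
    avoids = trans (cong₂ (λ a b → a + c * b) p₀ (δ-≢ e≢e₀)) (x+y*0≡x 0ℤ c)
    telescope : ∀ a b d → (b - a) + (d - b) ≡ d - a
    telescope = solve-∀
    balance′ : ∀ v → netInflow G D (λ e′ → p e′ + c * δ e e′) v ≡ δ r′ v - δ s v
    balance′ v = begin
      netInflow G D (λ e′ → p e′ + c * δ e e′) v        ≡⟨ netInflow-linear G D p c (δ e) v ⟩
      netInflow G D p v + c * netInflow G D (δ e) v     ≡⟨ cong₂ (λ a b → a + c * b) (balance v) (netInflow-δ G e v) ⟩
      (δ r v - δ s v) + c * (δ (end₁ G e) v - δ (end₂ G e) v) ≡⟨ cong (δ r v - δ s v +_) (shift v) ⟩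
      (δ r v - δ s v) + (δ r′ v - δ r v)                ≡⟨ telescope (δ s v) (δ r v) (δ r′ v) ⟩
      δ r′ v - δ s v                                    ∎
      where open ≡-Reasoning

  Step : Subset n → Fin n → Edge G → Set
  Step p v e = e ≢ e₀ × (end₁ G e ≡ v × end₂ G e ∈ p ⊎ end₂ G e ≡ v × end₁ G e ∈ p)

  step? : ∀ p v → Decidable (Step p v)
  step? p v e = ¬? (e ≟ e₀) ×-dec ((end₁ G e ≟ v ×-dec end₂ G e ∈? p) ⊎-dec (end₂ G e ≟ v ×-dec end₁ G e ∈? p))

  extendable? : ∀ p → Decidable (λ v → v ∈ p ⊎ ∃ (Step p v))
  extendable? p v = v ∈? p ⊎-dec any? (step? p v)

  extend : Subset n → Subset n
  extend p = select (extendable? p)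

  extend-inflationary : ∀ p → p ⊆ extend p
  extend-inflationary p x∈p = ∈-select⁺ (extendable? p) (inj₁ x∈p)

  extend-monotone : ∀ {p q} → p ⊆ q → extend p ⊆ extend q
  extend-monotone {p} {q} p⊆q x∈ with ∈-select⁻ (extendable? p) x∈
  ... | inj₁ x∈p = ∈-select⁺ (extendable? q) (inj₁ (p⊆q x∈p))
  ... | inj₂ (e , e≢e₀ , inj₁ (end₁≡ , end₂∈)) =
    ∈-select⁺ (extendable? q) (inj₂ (e , e≢e₀ , inj₁ (end₁≡ , p⊆q end₂∈)))
  ... | inj₂ (e , e≢e₀ , inj₂ (end₂≡ , end₁∈)) =
    ∈-select⁺ (extendable? q) (inj₂ (e , e≢e₀ , inj₂ (end₂≡ , p⊆q end₁∈)))

  routes-extend : ∀ {p} → (∀ {x} → x ∈ p → Route x) → ∀ {x} → x ∈ extend p → Route x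
  routes-extend {p} routes x∈ with ∈-select⁻ (extendable? p) x∈
  ... | inj₁ x∈p = routes x∈p
  ... | inj₂ (e , e≢e₀ , inj₁ (refl , end₂∈)) =
    route-along {end₂ G e} {end₁ G e} 1ℤ e e≢e₀ (λ v → ℤP.*-identityˡ _) (routes end₂∈)
  ... | inj₂ (e , e≢e₀ , inj₂ (refl , end₁∈)) =
    route-along {end₁ G e} {end₂ G e} -1ℤ e e≢e₀ (λ v → reverse (δ (end₁ G e) v) (δ (end₂ G e) v)) (routes end₁∈)
    where
    reverse : ∀ a b → -1ℤ * (a - b) ≡ b - a
    reverse = solve-∀

  reached : Subset n
  reached = fold ⁅ s ⁆ extend n

  reached-routes : ∀ k {x} → x ∈ fold ⁅ s ⁆ extend k → Route x
  reached-routes ℕ.zero    x∈⁅s⁆ = subst Route (sym (x∈⁅y⁆⇒x≡y s x∈⁅s⁆)) route-start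
  reached-routes (ℕ.suc k) x∈    = routes-extend (reached-routes k) x∈

  close : ∀ {x} → x ∈ reached ⊎ ∃ (Step reached x) → x ∈ reached
  close = fixpoint-within extend extend-inflationary extend-monotone ⁅ s ⁆ ∘ ∈-select⁺ (extendable? reached)

  side : Fin n → Bool
  side v = does (v ∈? reached)

  closed : ∀ e → e ≢ e₀ → differ (does (end₁ G e ∈? reached)) (does (end₂ G e ∈? reached)) ≡ 0
  closed e e≢e₀ with end₁ G e ∈? reached | end₂ G e ∈? reached
  ... | yes _     | yes _      = refl
  ... | no  _     | no  _      = refl
  ... | yes end₁∈ | no  end₂∉  = contradiction (close (inj₂ (e , e≢e₀ , inj₂ (refl , end₁∈)))) end₂∉
  ... | no  end₁∉ | yes end₂∈  = contradiction (close (inj₂ (e , e≢e₀ , inj₁ (refl , end₂∈)))) end₁∉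

  s∈reached : s ∈ reached
  s∈reached = fold-⊇ extend extend-inflationary extend-monotone ⁅ s ⁆ n (x∈⁅x⁆ s)

  bridge : t ∉ reached → cutSize G side ≡ 1
  bridge t∉ = trans (cutSize≡sum G side) (trans (ℕΣ.sum-supported e₀ _ closed) e₀-crosses)
    where
    e₀-crosses : differ (side s) (side t) ≡ 1
    e₀-crosses rewrite dec-true (s ∈? reached) s∈reached | dec-false (t ∈? reached) t∉ = refl

  circulation : Bridgeless G → Σ (Edge G → ℤ) λ f → (∀ v → netInflow G D f v ≡ 0ℤ) × f e₀ ≡ 1ℤ
  circulation bridgeless with t ∈? reached
  ... | no t∉ = contradiction (bridge t∉)
                  (bridgeless (side , (s , dec-true (s ∈? reached) s∈reached) , (t , dec-false (t ∈? reached) t∉)))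
  ... | yes t∈ with reached-routes n t∈
  ...   | p , p₀ , balance = (λ e → p e + 1ℤ * δ e₀ e) , balanced , value
    where
    cancel : ∀ a b → (b - a) + 1ℤ * (a - b) ≡ 0ℤ
    cancel = solve-∀
    balanced : ∀ v → netInflow G D (λ e → p e + 1ℤ * δ e₀ e) v ≡ 0ℤ
    balanced v = trans (netInflow-linear G D p 1ℤ (δ e₀) v)
                 (trans (cong₂ (λ a b → a + 1ℤ * b) (balance v) (netInflow-δ G e₀ v))
                        (cancel (δ s v) (δ t v)))
    value : p e₀ + 1ℤ * δ e₀ e₀ ≡ 1ℤ
    value = cong₂ (λ a b → a + 1ℤ * b) p₀ (δ-refl e₀)

horner : ℕ → ∀ {k} → (Fin k → ℤ) → ℤ
horner K {ℕ.zero}  a = 0ℤ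
horner K {ℕ.suc k} a = a zero + ℤ.+ K * horner K (a ∘ suc)

small+multiple≢0 : ∀ a c K → ∣ a ∣ < K → c ≢ 0ℤ → a + ℤ.+ K * c ≢ 0ℤ
small+multiple≢0 a c K |a|<K c≢0 a+Kc≡0 = ℕP.<⇒≱ |a|<K (begin
  K                 ≤⟨ ℕP.m≤m*n K ∣ c ∣ {{≢-nonZero (c≢0 ∘ ℤP.∣i∣≡0⇒i≡0)}} ⟩
  K ℕ.* ∣ c ∣       ≡⟨ ℤP.∣i*j∣≡∣i∣*∣j∣ (ℤ.+ K) c ⟨
  ∣ ℤ.+ K * c ∣     ≡⟨ ℤP.∣-i∣≡∣i∣ (ℤ.+ K * c) ⟨
  ∣ - (ℤ.+ K * c) ∣ ≡⟨ cong ∣_∣ (inverseˡ-unique a (ℤ.+ K * c) a+Kc≡0) ⟨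
  ∣ a ∣             ∎)
  where open ℕP.≤-Reasoning

horner-digits : ∀ K {k} (a : Fin k → ℤ) → (∀ i → ∣ a i ∣ < K) → horner K a ≡ 0ℤ → ∀ i → a i ≡ 0ℤ
horner-digits K {ℕ.suc k} a small value≡0 i with horner K (a ∘ suc) ℤ.≟ 0ℤ
... | no  rest≢0 = contradiction value≡0 (small+multiple≢0 (a zero) _ K (small zero) rest≢0)
... | yes rest≡0 with i
...   | zero  = trans (sym (trans (cong (λ r → a zero + ℤ.+ K * r) rest≡0) (x+y*0≡x (a zero) (ℤ.+ K))))
                      value≡0
...   | suc j = horner-digits K (a ∘ suc) (small ∘ suc) rest≡0 j

horner-balanced : ∀ {n} (G : Graph n) {σ : Signature G} (D : Orientation G σ) K {k}
  (f : Fin k → Edge G → ℤ) → (∀ i v → netInflow G D (f i) v ≡ 0ℤ) →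
  ∀ v → netInflow G D (λ e → horner K (λ i → f i e)) v ≡ 0ℤ
horner-balanced G D K {ℕ.zero}  f balanced v = netInflow-zero G D v
horner-balanced G D K {ℕ.suc k} f balanced v =
  trans (netInflow-linear G D (f zero) (ℤ.+ K) (λ e → horner K (λ i → f (suc i) e)) v)
  (trans (cong₂ (λ a b → a + ℤ.+ K * b) (balanced zero v)
                (horner-balanced G D K (f ∘ suc) (balanced ∘ suc) v))
         (x+y*0≡x 0ℤ (ℤ.+ K)))

bridgeless⇒flowAdmissible : ∀ {n} (G : Graph n) → Bridgeless G → FlowAdmissibleUnsigned G
bridgeless⇒flowAdmissible G bridgeless =
  suc (ℕΣ.sum (∣_∣ ∘ F)) , towardsEnd₁ G , F , flow , λ e → nonzero e , s≤s (term≤sum (∣_∣ ∘ F) e)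
  where
  through : ∀ i → Σ (Edge G → ℤ) λ f → (∀ v → netInflow G (towardsEnd₁ G) f v ≡ 0ℤ) × f i ≡ 1ℤ
  through i = Reachability.circulation G i bridgeless

  circulation : Edge G → Edge G → ℤ
  circulation i = proj₁ (through i)

  K : ℕ
  K = suc (ℕΣ.sum λ i → ℕΣ.sum λ e → ∣ circulation i e ∣)

  F : Edge G → ℤ
  F e = horner K (λ i → circulation i e)

  small : ∀ e i → ∣ circulation i e ∣ < K
  small e i = s≤s (ℕP.≤-trans (term≤sum (λ e → ∣ circulation i e ∣) e)
                              (term≤sum (λ i → ℕΣ.sum λ e → ∣ circulation i e ∣) i))

  flow : IsFlow G (towardsEnd₁ G) F
  flow = Equivalence.from (isFlow⇔balanced G (towardsEnd₁ G) F)
    (horner-balanced G (towardsEnd₁ G) K circulation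
      (λ i → proj₁ (proj₂ (through i))))

  nonzero : ∀ e → 0 < ∣ F e ∣
  nonzero e = ℕP.n≢0⇒n>0 λ |Fe|≡0 → contradiction
    (trans (sym (horner-digits K (λ i → circulation i e) (small e) (ℤP.∣i∣≡0⇒i≡0 |Fe|≡0) e))
           (proj₂ (proj₂ (through e))))
    λ ()

-- Flux of a flow into a vertex set

inflow-not : ∀ d x → inflow d x ≡ - inflow (not d) x
inflow-not true  x = sym (ℤP.neg-involutive x)
inflow-not false x = refl

inflow≢0 : ∀ d {x} → x ≢ 0ℤ → inflow d x ≢ 0ℤ
inflow≢0 true  x≢0 = x≢0
inflow≢0 false x≢0 = x≢0 ∘ ℤP.neg-injective

differ≡0⇔ : ∀ a b {A} → A ≢ 0ℤ → (differ a b ≡ 0 ⇔ (𝟙 a - 𝟙 b) * A ≡ 0ℤ)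
differ≡0⇔ true  true  A≢0 = mk⇔ (λ _ → refl) (λ _ → refl)
differ≡0⇔ false false A≢0 = mk⇔ (λ _ → refl) (λ _ → refl)
differ≡0⇔ true  false {A} A≢0 = mk⇔ (λ ()) (λ A≡0 → contradiction (trans (sym (ℤP.*-identityˡ A)) A≡0) A≢0)
differ≡0⇔ false true  {A} A≢0 = mk⇔ (λ ())
  (λ -A≡0 → contradiction (ℤP.neg-injective (trans (sym (ℤP.-1*i≡-i A)) -A≡0)) A≢0)

module Flux {n} {G : Graph n} {σ : Signature G} (D : Orientation G σ) (φ : Edge G → ℤ) where

  φ₁ : Edge G → ℤ
  φ₁ e = inflow (dir₁ D e) (φ e)

  entering : (Fin n → Bool) → Edge G → ℤ
  entering W e = 𝟙 (W (end₁ G e)) * φ₁ e + 𝟙 (W (end₂ G e)) * inflow (dir₂ D e) (φ e)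

  sum-entering : ∀ W → ℤΣ.sum (entering W) ≡ ℤΣ.sum (λ v → 𝟙 (W v) * netInflow G D φ v)
  sum-entering W = begin
    ℤΣ.sum (entering W)
      ≡⟨ ℤΣ.sum-cong-≗ (λ e → sym (cong₂ _+_ (sum-δ (end₁ G e) (λ v → 𝟙 (W v) * A e))
                                              (sum-δ (end₂ G e) (λ v → 𝟙 (W v) * B e)))) ⟩
    ℤΣ.sum (λ e → ℤΣ.sum (λ v → δ (end₁ G e) v * (𝟙 (W v) * A e)) + ℤΣ.sum (λ v → δ (end₂ G e) v * (𝟙 (W v) * B e)))
      ≡⟨ ℤΣ.sum-cong-≗ (λ e → ℤΣ.∑-distrib-+ (λ v → δ (end₁ G e) v * (𝟙 (W v) * A e))
                                             (λ v → δ (end₂ G e) v * (𝟙 (W v) * B e))) ⟨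
    ℤΣ.sum (λ e → ℤΣ.sum (λ v → δ (end₁ G e) v * (𝟙 (W v) * A e) + δ (end₂ G e) v * (𝟙 (W v) * B e)))
      ≡⟨ ℤΣ.sum-cong-≗ (λ e → ℤΣ.sum-cong-≗ (λ v → pull (δ (end₁ G e) v) (δ (end₂ G e) v) (𝟙 (W v)) (A e) (B e))) ⟩
    ℤΣ.sum (λ e → ℤΣ.sum (λ v → 𝟙 (W v) * (δ (end₁ G e) v * A e + δ (end₂ G e) v * B e)))
      ≡⟨ ℤΣ.∑-comm (λ e v → 𝟙 (W v) * (δ (end₁ G e) v * A e + δ (end₂ G e) v * B e)) ⟩
    ℤΣ.sum (λ v → ℤΣ.sum (λ e → 𝟙 (W v) * (δ (end₁ G e) v * A e + δ (end₂ G e) v * B e)))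
      ≡⟨ ℤΣ.sum-cong-≗ (λ v → ℤΣ.*-distribˡ-sum (𝟙 (W v)) (λ e → δ (end₁ G e) v * A e + δ (end₂ G e) v * B e)) ⟨
    ℤΣ.sum (λ v → 𝟙 (W v) * netInflow G D φ v) ∎
    where
    open ≡-Reasoning
    A B : Edge G → ℤ
    A = φ₁
    B e = inflow (dir₂ D e) (φ e)
    pull : ∀ i j w a b → i * (w * a) + j * (w * b) ≡ w * (i * a + j * b)
    pull = solve-∀

  sum-entering≡0 : IsFlow G D φ → ∀ W → ℤΣ.sum (entering W) ≡ 0ℤ
  sum-entering≡0 flow W = trans (sum-entering W) (ℤΣ.sum-zero _ λ v →
    trans (cong (𝟙 (W v) *_) (Equivalence.to (isFlow⇔balanced G D φ) flow v)) (ℤP.*-zeroʳ (𝟙 (W v))))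

  entering-positive : ∀ {e} W → σ e ≡ Sign.+ → entering W e ≡ (𝟙 (W (end₁ G e)) - 𝟙 (W (end₂ G e))) * φ₁ e
  entering-positive {e} W positive = begin
    𝟙 (W (end₁ G e)) * φ₁ e + 𝟙 (W (end₂ G e)) * inflow (dir₂ D e) (φ e)
      ≡⟨ cong (λ z → 𝟙 (W (end₁ G e)) * φ₁ e + 𝟙 (W (end₂ G e)) * z) opposite ⟩
    𝟙 (W (end₁ G e)) * φ₁ e + 𝟙 (W (end₂ G e)) * - φ₁ e
      ≡⟨ factor (𝟙 (W (end₁ G e))) (𝟙 (W (end₂ G e))) (φ₁ e) ⟩
    (𝟙 (W (end₁ G e)) - 𝟙 (W (end₂ G e))) * φ₁ e ∎
    where
    open ≡-Reasoning
    opposite : inflow (dir₂ D e) (φ e) ≡ - φ₁ e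
    opposite = trans (inflow-not (dir₂ D e) (φ e)) (cong (λ d → - inflow d (φ e)) (sym (valid₊ D e positive)))
    factor : ∀ a b x → a * x + b * - x ≡ (a - b) * x
    factor = solve-∀

  entering-negative : ∀ {e a b} W → σ e ≡ Sign.- → Joins G e a b → entering W e ≡ (𝟙 (W a) + 𝟙 (W b)) * φ₁ e
  entering-negative {e} {a} {b} W negative (inj₁ ends≡ab) rewrite ends≡ab | valid₋ D e negative =
    sym (ℤP.*-distribʳ-+ (inflow (dir₂ D e) (φ e)) (𝟙 (W a)) (𝟙 (W b)))
  entering-negative {e} {a} {b} W negative (inj₂ ends≡ba) rewrite ends≡ba | valid₋ D e negative =
    trans (ℤP.+-comm (𝟙 (W b) * inflow (dir₂ D e) (φ e)) (𝟙 (W a) * inflow (dir₂ D e) (φ e)))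
          (sym (ℤP.*-distribʳ-+ (inflow (dir₂ D e) (φ e)) (𝟙 (W a)) (𝟙 (W b))))

  crossing≡0⇔entering≡0 : ∀ {e} W → σ e ≡ Sign.+ → φ e ≢ 0ℤ →
                           (crossing W (ends G e) ≡ 0 ⇔ entering W e ≡ 0ℤ)
  crossing≡0⇔entering≡0 {e} W positive φe≢0 = mk⇔
    (λ c≡0 → trans (entering-positive W positive) (Equivalence.to zeros c≡0))
    (λ i≡0 → Equivalence.from zeros (trans (sym (entering-positive W positive)) i≡0))
    where
    zeros : differ (W (end₁ G e)) (W (end₂ G e)) ≡ 0 ⇔ (𝟙 (W (end₁ G e)) - 𝟙 (W (end₂ G e))) * φ₁ e ≡ 0ℤ
    zeros = differ≡0⇔ (W (end₁ G e)) (W (end₂ G e)) (inflow≢0 (dir₁ D e) φe≢0)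

scaled-difference : ∀ a b A R → A ≢ 0ℤ → a * A + (b * - A + R) ≡ 0ℤ → (R ≡ 0ℤ ⇔ a ≡ b)
scaled-difference a b A R A≢0 total≡0 = mk⇔ to from
  where
  rearrange : ∀ a b A R → a * A + (b * - A + R) ≡ (a - b) * A + R
  rearrange = solve-∀
  collapse : ∀ a A R → (a - a) * A + R ≡ R
  collapse = solve-∀
  difference≡0 : (a - b) * A + R ≡ 0ℤ
  difference≡0 = trans (sym (rearrange a b A R)) total≡0

  to : R ≡ 0ℤ → a ≡ b
  to R≡0 with ℤP.i*j≡0⇒i≡0∨j≡0 (a - b)
                (trans (sym (ℤP.+-identityʳ _)) (trans (cong ((a - b) * A +_) (sym R≡0)) difference≡0))
  ... | inj₁ a-b≡0 = ℤP.i-j≡0⇒i≡j a b a-b≡0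
  ... | inj₂ A≡0   = contradiction A≡0 A≢0

  from : a ≡ b → R ≡ 0ℤ
  from refl = trans (sym (collapse a A R)) difference≡0

-- a, b, c, d are the sides of u, v, x, y, and s counts the other edges of G crossing the cut.
bridge-sides : ∀ a b c d s → differ a c ℕ.+ s ≡ 1 → (s ≡ 0 ⇔ 𝟙 a + 𝟙 b ≡ 𝟙 c + 𝟙 d) →
               differ a b ℕ.+ (differ c d ℕ.+ s) ≡ 2 × (a ≢ b ⊎ c ≢ d)
bridge-sides true  true  true  true  _ refl s≡0⇔ = contradiction (Equivalence.from s≡0⇔ refl) λ ()
bridge-sides true  true  true  false _ refl _    = refl , inj₂ λ ()
bridge-sides true  false true  true  _ refl _    = refl , inj₁ λ ()
bridge-sides true  false true  false _ refl s≡0⇔ = contradiction (Equivalence.from s≡0⇔ refl) λ ()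
bridge-sides false true  false true  _ refl s≡0⇔ = contradiction (Equivalence.from s≡0⇔ refl) λ ()
bridge-sides false true  false false _ refl _    = refl , inj₁ λ ()
bridge-sides false false false true  _ refl _    = refl , inj₂ λ ()
bridge-sides false false false false _ refl s≡0⇔ = contradiction (Equivalence.from s≡0⇔ refl) λ ()
bridge-sides true  false false true  _ refl _    = refl , inj₁ λ ()
bridge-sides true  true  false true  _ refl s≡0⇔ = contradiction (Equivalence.to s≡0⇔ refl) λ ()
bridge-sides true  true  false false _ refl s≡0⇔ = contradiction (Equivalence.to s≡0⇔ refl) λ ()
bridge-sides true  false false false _ refl s≡0⇔ = contradiction (Equivalence.to s≡0⇔ refl) λ ()
bridge-sides false true  true  false _ refl _    = refl , inj₁ λ ()
bridge-sides false false true  true  _ refl s≡0⇔ = contradiction (Equivalence.to s≡0⇔ refl) λ ()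
bridge-sides false false true  false _ refl s≡0⇔ = contradiction (Equivalence.to s≡0⇔ refl) λ ()
bridge-sides false true  true  true  _ refl s≡0⇔ = contradiction (Equivalence.to s≡0⇔ refl) λ ()

module NegativePair {n} {G : Graph n} {σ : Signature G} (D : Orientation G σ) {φ : Edge G → ℤ}
  (flow : IsFlow G D φ) (φ≢0 : ∀ e → φ e ≢ 0ℤ) {e₁ e₂ : Edge G} {u v x y : Fin n}
  (e₁≢e₂ : e₁ ≢ e₂) (joins₁ : Joins G e₁ u v) (joins₂ : Joins G e₂ x y)
  (onlyNegative : ∀ e → σ e ≡ Sign.- → e ≡ e₁ ⊎ e ≡ e₂)
  (negative₁ : σ e₁ ≡ Sign.-) (negative₂ : σ e₂ ≡ Sign.-) where

  open Flux D φ

  otherCrossings : (Fin n → Bool) → Edge G → ℕ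
  otherCrossings W = ℕΣ.erase e₂ (ℕΣ.erase e₁ (crossing W ∘ ends G))

  otherEntering : (Fin n → Bool) → Edge G → ℤ
  otherEntering W = ℤΣ.erase e₂ (ℤΣ.erase e₁ (entering W))

  positive : ∀ e → e ≢ e₁ → e ≢ e₂ → σ e ≡ Sign.+
  positive e e≢e₁ e≢e₂ with σ e in σe
  ... | Sign.+ = refl
  ... | Sign.- with onlyNegative e σe
  ...   | inj₁ e≡e₁ = contradiction e≡e₁ e≢e₁
  ...   | inj₂ e≡e₂ = contradiction e≡e₂ e≢e₂

  same-zeros : ∀ W e → otherCrossings W e ≡ 0 ⇔ otherEntering W e ≡ 0ℤ
  same-zeros W e with e ≟ e₂ | e ≟ e₁
  ... | yes _    | _        = mk⇔ (λ _ → refl) (λ _ → refl)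
  ... | no _     | yes _    = mk⇔ (λ _ → refl) (λ _ → refl)
  ... | no e≢e₂  | no e≢e₁  = crossing≡0⇔entering≡0 W (positive e e≢e₁ e≢e₂) (φ≢0 e)

  others≡0⇔ : ∀ W → ℕΣ.sum (otherCrossings W) ≤ 1 →
              (ℕΣ.sum (otherCrossings W) ≡ 0 ⇔ ℤΣ.sum (otherEntering W) ≡ 0ℤ)
  others≡0⇔ W = sum≡0⇔sum≡0 (otherCrossings W) (otherEntering W) (same-zeros W)

  flux-balance : ∀ W → (𝟙 (W u) + 𝟙 (W v)) * φ₁ e₁ + ((𝟙 (W x) + 𝟙 (W y)) * φ₁ e₂ + ℤΣ.sum (otherEntering W)) ≡ 0ℤ
  flux-balance W = trans
    (cong₂ (λ a b → a + (b + ℤΣ.sum (otherEntering W)))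
           (sym (entering-negative W negative₁ joins₁)) (sym (entering-negative W negative₂ joins₂)))
    (trans (sym (ℤΣ.sum-erase₂ (entering W) e₁≢e₂)) (sum-entering≡0 flow W))

  opposite : φ₁ e₂ ≡ - φ₁ e₁
  opposite with ℤP.i*j≡0⇒i≡0∨j≡0 (1ℤ + 1ℤ) (trans (double (φ₁ e₁) (φ₁ e₂)) (trans
                  (cong (λ r → (1ℤ + 1ℤ) * φ₁ e₁ + ((1ℤ + 1ℤ) * φ₁ e₂ + r)) (sym others≡0))
                  (flux-balance everything)))
    where
    everything : Fin n → Bool
    everything _ = true
    none-crossing : ℕΣ.sum (otherCrossings everything) ≡ 0
    none-crossing = ℕΣ.sum-zero (otherCrossings everything)
      (ℕΣ.erase-vanishes e₂ (λ i _ → ℕΣ.erase-vanishes e₁ (λ _ _ → refl) i))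
    others≡0 : ℤΣ.sum (otherEntering everything) ≡ 0ℤ
    others≡0 = Equivalence.to (others≡0⇔ everything (subst (_≤ 1) (sym none-crossing) z≤n)) none-crossing
    double : ∀ a b → (1ℤ + 1ℤ) * (a + b) ≡ (1ℤ + 1ℤ) * a + ((1ℤ + 1ℤ) * b + 0ℤ)
    double = solve-∀
  ... | inj₁ ()
  ... | inj₂ sum≡0 = inverseʳ-unique (φ₁ e₁) (φ₁ e₂) sum≡0

  cutSize-G : ∀ W → cutSize G W ≡ differ (W u) (W v) ℕ.+ (differ (W x) (W y) ℕ.+ ℕΣ.sum (otherCrossings W))
  cutSize-G W = trans (cutSize≡sum G W) (trans (ℕΣ.sum-erase₂ (crossing W ∘ ends G) e₁≢e₂)
    (cong₂ (λ a b → a ℕ.+ (b ℕ.+ ℕΣ.sum (otherCrossings W))) (crossing-joins G e₁ W joins₁) (crossing-joins G e₂ W joins₂)))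

  bridge⇒twoCut : ∀ W → cutSize (deleteTwoAdd G e₁ e₂ u x) W ≡ 1 →
                  cutSize G W ≡ 2 × (InCut G W e₁ ⊎ InCut G W e₂)
  bridge⇒twoCut W bridge with bridge-sides (W u) (W v) (W x) (W y) S ux+S≡1 S≡0⇔balanced
    where
    S : ℕ
    S = ℕΣ.sum (otherCrossings W)
    ux+S≡1 : differ (W u) (W x) ℕ.+ S ≡ 1
    ux+S≡1 = trans (sym (cutSize-deleteTwoAdd G e₁ e₂ u x W)) bridge
    S≡0⇔balanced : S ≡ 0 ⇔ 𝟙 (W u) + 𝟙 (W v) ≡ 𝟙 (W x) + 𝟙 (W y)
    S≡0⇔balanced = scaled-difference _ _ (φ₁ e₁) _ (inflow≢0 (dir₁ D e₁) (φ≢0 e₁))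
        (subst (λ z → (𝟙 (W u) + 𝟙 (W v)) * φ₁ e₁ + ((𝟙 (W x) + 𝟙 (W y)) * z + ℤΣ.sum (otherEntering W)) ≡ 0ℤ)
               opposite (flux-balance W))
      ⇔-∘ others≡0⇔ W (ℕP.≤-trans (ℕP.m≤n+m S _) (ℕP.≤-reflexive ux+S≡1))
  ... | size≡2 , crossed = trans (cutSize-G W) size≡2 ,
        Sum.map (inCut-joins G e₁ W joins₁) (inCut-joins G e₂ W joins₂) crossed

mainTheorem16 : ∀ {n : ℕ} (G : Graph n) (σ : Signature G)
    (e₁ e₂ : Edge G) (u v x y : Fin n) →
    Cubic G →
    FlowAdmissible G σ →
    e₁ ≢ e₂ →
    (ends G e₁ ≡ (u , v) ⊎ ends G e₁ ≡ (v , u)) →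
    (ends G e₂ ≡ (x , y) ⊎ ends G e₂ ≡ (y , x)) →
    (∀ e → σ e ≡ Sign.- → e ≡ e₁ ⊎ e ≡ e₂) →
    σ e₁ ≡ Sign.- → σ e₂ ≡ Sign.- →
    No2CutWithNegEdge G σ →
    FlowAdmissibleUnsigned (deleteTwoAdd G e₁ e₂ u x)
mainTheorem16 G σ e₁ e₂ u v x y _ (_ , D , φ , flow , nowhereZero) e₁≢e₂ joins₁ joins₂
              onlyNegative negative₁ negative₂ no2Cut =
  bridgeless⇒flowAdmissible (deleteTwoAdd G e₁ e₂ u x) λ (W , proper) bridge →
    let size≡2 , crossed = bridge⇒twoCut W bridge
        no-negative = no2Cut (W , proper) size≡2
    in [ no-negative e₁ negative₁ , no-negative e₂ negative₂ ]′ crossed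
  where
  φ≢0 : ∀ e → φ e ≢ 0ℤ
  φ≢0 e φe≡0 = contradiction (subst (λ z → 0 < ∣ z ∣) φe≡0 (proj₁ (nowhereZero e))) λ ()
  open NegativePair D flow φ≢0 e₁≢e₂ joins₁ joins₂ onlyNegative negative₁ negative₂
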